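{- Let $G$ be a closed $P$-oligomorphic permutation group of a countably infinite set $E$ whose nested block system consists of a single superblock, with maximal finite blocks $B_1,B_2,\dots$ of size $m$, and assume $G$ induces the full symmetric group on $\{B_1,B_2,\dots\}$. Let $H_0,H_1,H_2,\dots$ be the tower of $G$, viewed as subgroups of $\mathrm{Sym}(\{1,\dots,m\})$ via an enumeration of the blocks as in the following context. Then there is a normal subgroup $H$ of $H_0$ such that $H_i=H$ for all $i\ge1$; that is, the tower has the form $H_0,H,H,H,\dots$.
   Context: Profile: number of $G$-orbits on $n$-subsets; $P$-oligomorphic: polynomially bounded profile; closed: closed in $\mathrm{Sym}(E)$ for pointwise convergence. For $P$-oligomorphic $G$ there is a coarsest $G$-invariant partition of $E$ into finite blocks (the maximal finite blocks); the nested block system consists of a single superblock when $G$ has no finite orbit of points and acts primitively on the infinite set of these blocks. Under these hypotheses there is an enumeration $b_{1,i},\dots,b_{m,i}$ of each block $B_i$ such that for every permutation $\sigma$ of the block indices the map $b_{r,i}\mapsto b_{r,\sigma(i)}$ lies in $G$; use it to identify each block with $\{1,\dots,m\}$. Tower: let $S$ be the subgroup of $G$ stabilizing every block setwise; for $i\ge0$, $H_i$ is the restriction to $B_{i+1}$ of the pointwise stabilizer in $S$ of $B_1\cup\dots\cup B_i$, viewed in $\mathrm{Sym}(\{1,\dots,m\})$ (this does not depend on the choice of the blocks). -}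

module Defs where

open import Level using (0ℓ)
open import Data.Nat using (ℕ; zero; suc; _+_; _*_; _^_; _≤_; _<_)
open import Data.Fin using (Fin)
open import Data.Fin.Permutation using (Permutation′; _⟨$⟩ʳ_; _⟨$⟩ˡ_)
open import Data.Product using (Σ; ∃; _×_; _,_; proj₁; proj₂)
open import Data.List using (List; length; map)
open import Data.List.Membership.Propositional using (_∈_)
open import Data.List.Relation.Unary.Any using (Any)
open import Data.List.Relation.Unary.Unique.Propositional using (Unique)
open import Data.List.Relation.Binary.Permutation.Propositional using (_↭_)
open import Function using (_∘_; _↔_; Inverse)
open import Relation.Binary.PropositionalEquality using (_≡_)

-- The point (i , r) is b_{r,i+1}, i.e. the
-- r-th point of block B_{i+1} (block B_{i+1} = {i} × Fin m), the labelling
-- being the enumeration of the blocks from the context.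
E : ℕ → Set
E m = ℕ × Fin m

Sym : ℕ → Set
Sym m = E m ↔ E m

app : ∀ {m} → Sym m → E m → E m
app g = Inverse.to g

appInv : ∀ {m} → Sym m → E m → E m
appInv g = Inverse.from g

record PermGroup (m : ℕ) : Set₁ where
  field
    _∈G : Sym m → Set
    resp   : ∀ {g h} → (∀ x → app g x ≡ app h x) → g ∈G → h ∈G
    has-id : ∀ {g} → (∀ x → app g x ≡ x) → g ∈G
    has-comp : ∀ {g h k} → g ∈G → h ∈G →
               (∀ x → app k x ≡ app g (app h x)) → k ∈G
    has-inv  : ∀ {g h} → g ∈G → (∀ x → app h x ≡ appInv g x) → h ∈G
open PermGroup public

-- Closed in Sym(E) for the topology of pointwise convergence: every
-- permutation that can be approximated on every finite set by elements of
-- G lies in G. (The finite sets {(i , r) | i < n} are cofinal among finite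
-- subsets of E.)
Closed : ∀ {m} → PermGroup m → Set
Closed {m} G = ∀ (g : Sym m) →
  (∀ n → Σ (Sym m) λ h → (G ∈G) h × (∀ i r → i < n → app h (i , r) ≡ app g (i , r))) →
  (G ∈G) g

-- n-subsets of E, represented as duplicate-free lists of length n.
Subset : ℕ → ℕ → Set
Subset m n = Σ (List (E m)) λ xs → Unique xs × length xs ≡ n

SameOrbit : ∀ {m n} → PermGroup m → Subset m n → Subset m n → Set
SameOrbit {m} G A B =
  Σ (Sym m) λ g → (G ∈G) g × (map (app g) (proj₁ A) ↭ proj₁ B)

-- "The profile of G at n is at most k": there are at most k G-orbits on
-- n-subsets, i.e. some list of at most k n-subsets meets every orbit.
ProfileAtMost : ∀ {m} → PermGroup m → ℕ → ℕ → Set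
ProfileAtMost {m} G n k =
  Σ (List (Subset m n)) λ reps → length reps ≤ k ×
    (∀ (A : Subset m n) → Any (λ R → SameOrbit G A R) reps)

POligomorphic : ∀ {m} → PermGroup m → Set
POligomorphic G = Σ ℕ λ c → Σ ℕ λ d → ∀ n → ProfileAtMost G n (c * n ^ d + c)

record FiniteBlockSystem {m} (G : PermGroup m) : Set₁ where
  field
    _∼_   : E m → E m → Set
    ∼-refl  : ∀ x → x ∼ x
    ∼-sym   : ∀ {x y} → x ∼ y → y ∼ x
    ∼-trans : ∀ {x y z} → x ∼ y → y ∼ z → x ∼ z
    invariant : ∀ g → (G ∈G) g → ∀ {x y} → x ∼ y → app g x ∼ app g y
    finite : ∀ x → Σ (List (E m)) λ xs → ∀ y → x ∼ y → y ∈ xs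

-- The partition into the blocks {i} × Fin m is the coarsest G-invariant
-- partition of E into finite blocks (the maximal finite blocks of G).
BlocksAreMaximalFinite : ∀ {m} → PermGroup m → Set₁
BlocksAreMaximalFinite {m} G =
  (∀ g → (G ∈G) g → ∀ i r s → proj₁ (app g (i , r)) ≡ proj₁ (app g (i , s))) ×
  ((P : FiniteBlockSystem G) → ∀ x y → FiniteBlockSystem._∼_ P x y → proj₁ x ≡ proj₁ y)

-- The enumeration of the blocks from the context: for every permutation σ
-- of the block indices, the map b_{r,i} ↦ b_{r,σ(i)} lies in G.
-- (This in particular says G induces the full symmetric group on blocks.)
BlockPermutationsInG : ∀ {m} → PermGroup m → Set
BlockPermutationsInG {m} G = ∀ (σ : ℕ ↔ ℕ) (g : Sym m) →
  (∀ i r → app g (i , r) ≡ (Inverse.to σ i , r)) → (G ∈G) g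

InducesFullSymOnBlocks : ∀ {m} → PermGroup m → Set
InducesFullSymOnBlocks {m} G = ∀ (σ : ℕ ↔ ℕ) →
  Σ (Sym m) λ g → (G ∈G) g × (∀ i r → proj₁ (app g (i , r)) ≡ Inverse.to σ i)

-- S = elements of G fixing every block setwise.
-- Tower G k π (k ≥ 0) : π ∈ H_k, i.e. π is the restriction to B_{k+1}
-- (= {k} × Fin m) of some element of S fixing B_1 ∪ … ∪ B_k
-- (= {j < k} × Fin m) pointwise.
Tower : ∀ {m} → PermGroup m → ℕ → Permutation′ m → Set
Tower {m} G k π = Σ (Sym m) λ g → (G ∈G) g ×
  (∀ i r → proj₁ (app g (i , r)) ≡ i) ×
  (∀ j r → j < k → app g (j , r) ≡ (j , r)) ×
  (∀ r → app g (k , r) ≡ (k , π ⟨$⟩ʳ r))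

IsNormalSubgroupOf : ∀ {m} → (Permutation′ m → Set) → (Permutation′ m → Set) → Set
IsNormalSubgroupOf {m} H K =
  (∀ π → H π → K π) ×
  (∀ π → (∀ r → π ⟨$⟩ʳ r ≡ r) → H π) ×
  (∀ π ρ τ → H π → H ρ → (∀ r → τ ⟨$⟩ʳ r ≡ π ⟨$⟩ʳ (ρ ⟨$⟩ʳ r)) → H τ) ×
  (∀ π τ → H π → (∀ r → τ ⟨$⟩ʳ r ≡ π ⟨$⟩ˡ r) → H τ) ×
  (∀ κ π τ → K κ → H π →
     (∀ r → τ ⟨$⟩ʳ r ≡ κ ⟨$⟩ʳ (π ⟨$⟩ʳ (κ ⟨$⟩ˡ r))) → H τ)

-- An element of G fixing every block setwise is the family (φ i)ᵢ of
-- permutations it induces on the blocks, and conjugating it by the block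
-- permutation b_{r,i} ↦ b_{r,σ(i)} reindexes that family along σ.  Thus
-- π ∈ H_k says that some realisable family is trivial below k and equals π
-- at k.  Reindexing along a transposition moves block k to block 1 (block 0
-- stays trivial), so H_k ⊆ H_1.  Conversely, a witness for π ∈ H_1 can be
-- reindexed to a family ρ with ρ k = id and ρ (k+1) = π, and then the
-- realisable family i ↦ ρ ((k k+1) i) ∘ (ρ i)⁻¹ is trivial off {k, k+1} and
-- equals π at k, so H_1 ⊆ H_k.  Normality of H_k in H_0 is pointwise
-- conjugation after moving block 0 to block k.
module Submission where

open import Defs
open import Data.Nat using (ℕ; zero; suc; _≤_; _<_; s≤s; NonZero; _≟_)
open import Data.Nat.Properties using (<⇒≢; n<1+n; m<n⇒m<1+n; 1+n≢n)
open import Data.Fin using (Fin)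
open import Data.Fin.Permutation
  using (Permutation′; _⟨$⟩ʳ_; _⟨$⟩ˡ_; _≈_; _∘ₚ_; flip; id; inverseˡ; inverseʳ)
open import Data.Product using (Σ; _×_; _,_; proj₁; proj₂)
open import Data.Product.Function.NonDependent.Propositional using (_×-↔_)
open import Function using (_∘_; _⇔_; _↔_; Inverse; mk⇔; mk↔ₛ′)
open import Function.Construct.Composition using (_↔-∘_)
open import Function.Construct.Identity using (↔-id)
open import Function.Construct.Symmetry using (↔-sym)
open import Relation.Binary.PropositionalEquality
open import Relation.Nullary using (yes; no; contradiction)

transpose : ℕ → ℕ → ℕ → ℕ
transpose a b i with i ≟ a
... | yes _ = b
... | no _ with i ≟ b
...   | yes _ = a
...   | no _ = i

transpose-ˡ : ∀ a b → transpose a b a ≡ b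
transpose-ˡ a b with a ≟ a
... | yes _ = refl
... | no a≢a = contradiction refl a≢a

transpose-ʳ : ∀ a b → transpose a b b ≡ a
transpose-ʳ a b with b ≟ a
... | yes b≡a = b≡a
... | no _ with b ≟ b
...   | yes _ = refl
...   | no b≢b = contradiction refl b≢b

transpose-≢ : ∀ a b {i} → i ≢ a → i ≢ b → transpose a b i ≡ i
transpose-≢ a b {i} i≢a i≢b with i ≟ a
... | yes i≡a = contradiction i≡a i≢a
... | no _ with i ≟ b
...   | yes i≡b = contradiction i≡b i≢b
...   | no _ = refl

transpose-involutive : ∀ a b i → transpose a b (transpose a b i) ≡ i
transpose-involutive a b i with i ≟ a
... | yes refl = transpose-ʳ i b
... | no i≢a with i ≟ b
...   | yes refl = transpose-ˡ a i
...   | no i≢b = transpose-≢ a b i≢a i≢b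

transposition : ℕ → ℕ → ℕ ↔ ℕ
transposition a b =
  mk↔ₛ′ (transpose a b) (transpose a b) (transpose-involutive a b) (transpose-involutive a b)

flip-cong : ∀ {m} (π ρ : Permutation′ m) → π ≈ ρ → flip π ≈ flip ρ
flip-cong π ρ π≈ρ r = begin
  π ⟨$⟩ˡ r                        ≡⟨ cong (π ⟨$⟩ˡ_) (sym (inverseʳ ρ)) ⟩
  π ⟨$⟩ˡ (ρ ⟨$⟩ʳ (ρ ⟨$⟩ˡ r))      ≡⟨ cong (π ⟨$⟩ˡ_) (sym (π≈ρ (ρ ⟨$⟩ˡ r))) ⟩
  π ⟨$⟩ˡ (π ⟨$⟩ʳ (ρ ⟨$⟩ˡ r))      ≡⟨ inverseˡ π ⟩
  ρ ⟨$⟩ˡ r                        ∎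
  where open ≡-Reasoning

module _ {m : ℕ} (G : PermGroup m) where

  BlockFamily : Set
  BlockFamily = ℕ → Permutation′ m

  _ActsAs_ : Sym m → BlockFamily → Set
  g ActsAs φ = ∀ i r → app g (i , r) ≡ (i , φ i ⟨$⟩ʳ r)

  record Realisable (φ : BlockFamily) : Set where
    constructor realised
    field
      element : Sym m
      element∈G : (G ∈G) element
      element-actsAs : element ActsAs φ

  realisable-id : Realisable (λ _ → id)
  realisable-id = realised (↔-id (E m)) (has-id G (λ _ → refl)) (λ _ _ → refl)

  realisable-∘ : ∀ {φ ψ} → Realisable φ → Realisable ψ → Realisable (λ i → φ i ∘ₚ ψ i)
  realisable-∘ {φ} {ψ} (realised g g∈G g≈φ) (realised h h∈G h≈ψ) =
    realised (h ↔-∘ g) (has-comp G h∈G g∈G (λ _ → refl))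
      λ i r → trans (cong (app h) (g≈φ i r)) (h≈ψ i (φ i ⟨$⟩ʳ r))

  realisable-flip : ∀ {φ} → Realisable φ → Realisable (flip ∘ φ)
  realisable-flip {φ} (realised g g∈G g≈φ) =
    realised (↔-sym g) (has-inv G g∈G (λ _ → refl)) g⁻¹≈φ⁻¹
    where
    g⁻¹≈φ⁻¹ : ↔-sym g ActsAs (flip ∘ φ)
    g⁻¹≈φ⁻¹ i r = begin
      appInv g (i , r)                               ≡⟨ cong (λ s → appInv g (i , s)) (sym (inverseʳ (φ i))) ⟩
      appInv g (i , φ i ⟨$⟩ʳ (φ i ⟨$⟩ˡ r))           ≡⟨ cong (appInv g) (sym (g≈φ i (φ i ⟨$⟩ˡ r))) ⟩
      appInv g (app g (i , φ i ⟨$⟩ˡ r))              ≡⟨ Inverse.strictlyInverseʳ g _ ⟩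
      (i , φ i ⟨$⟩ˡ r)                               ∎
      where open ≡-Reasoning

  module BlockRestriction (g : Sym m) (stable : ∀ i r → proj₁ (app g (i , r)) ≡ i) where

    stable⁻¹ : ∀ i r → proj₁ (appInv g (i , r)) ≡ i
    stable⁻¹ i r = trans (sym (stable (proj₁ x) (proj₂ x))) (cong proj₁ (Inverse.strictlyInverseˡ g (i , r)))
      where x = appInv g (i , r)

    restriction : BlockFamily
    restriction i = mk↔ₛ′ (λ r → proj₂ (app g (i , r))) (λ r → proj₂ (appInv g (i , r)))
      (λ r → trans (cong (λ j → proj₂ (app g (j , proj₂ (appInv g (i , r))))) (sym (stable⁻¹ i r)))
                   (cong proj₂ (Inverse.strictlyInverseˡ g (i , r))))
      (λ r → trans (cong (λ j → proj₂ (appInv g (j , proj₂ (app g (i , r))))) (sym (stable i r)))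
                   (cong proj₂ (Inverse.strictlyInverseʳ g (i , r))))

    actsAs-restriction : g ActsAs restriction
    actsAs-restriction i r = cong (_, proj₂ (app g (i , r))) (stable i r)

  record TowerWitness (k : ℕ) (π : Permutation′ m) : Set where
    constructor witness
    field
      family : BlockFamily
      realisable : Realisable family
      trivial-below : ∀ j → j < k → family j ≈ id
      restricts-to : family k ≈ π

  tower⇒witness : ∀ {k π} → Tower G k π → TowerWitness k π
  tower⇒witness (g , g∈G , stable , fixes , acts) =
    witness restriction (realised g g∈G actsAs-restriction)
      (λ j j<k r → cong proj₂ (fixes j r j<k)) (λ r → cong proj₂ (acts r))
    where open BlockRestriction g stable

  witness⇒tower : ∀ {k π} → TowerWitness k π → Tower G k π
  witness⇒tower {k} (witness φ (realised g g∈G g≈φ) trivial at-k) =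
    g , g∈G , (λ i r → cong proj₁ (g≈φ i r)) ,
    (λ j r j<k → trans (g≈φ j r) (cong (j ,_) (trivial j j<k r))) ,
    λ r → trans (g≈φ k r) (cong (k ,_) (at-k r))

  witness-id : ∀ {k π} → π ≈ id → TowerWitness k π
  witness-id π≈id = witness (λ _ → id) realisable-id (λ _ _ _ → refl) (λ r → sym (π≈id r))

  witness-∘ : ∀ {k π ρ τ} → TowerWitness k π → TowerWitness k ρ →
              τ ≈ ρ ∘ₚ π → TowerWitness k τ
  witness-∘ {k} (witness φ φ-real φ-trivial φ-at) (witness ψ ψ-real ψ-trivial ψ-at) τ≈ρ∘π =
    witness (λ i → ψ i ∘ₚ φ i) (realisable-∘ ψ-real φ-real)
      (λ j j<k r → trans (cong (φ j ⟨$⟩ʳ_) (ψ-trivial j j<k r)) (φ-trivial j j<k r))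
      (λ r → trans (cong (φ k ⟨$⟩ʳ_) (ψ-at r)) (trans (φ-at _) (sym (τ≈ρ∘π r))))

  witness-flip : ∀ {k π τ} → TowerWitness k π → τ ≈ flip π → TowerWitness k τ
  witness-flip {k} {π} (witness φ φ-real φ-trivial φ-at) τ≈π⁻¹ =
    witness (flip ∘ φ) (realisable-flip φ-real)
      (λ j j<k → flip-cong (φ j) id (φ-trivial j j<k))
      (λ r → trans (flip-cong (φ k) π φ-at r) (sym (τ≈π⁻¹ r)))

  module _ (blockPerms : BlockPermutationsInG G) where

    realisable-reindex : ∀ (σ : ℕ ↔ ℕ) {φ} → Realisable φ → Realisable (φ ∘ Inverse.to σ)
    realisable-reindex σ {φ} (realised g g∈G g≈φ) =
      realised (bσ⁻¹ ↔-∘ (g ↔-∘ bσ))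
        (has-comp G (blockPerm∈G (↔-sym σ)) g∘bσ∈G (λ _ → refl))
        λ i r → trans (cong (app bσ⁻¹) (g≈φ (Inverse.to σ i) r))
                      (cong (_, φ (Inverse.to σ i) ⟨$⟩ʳ r) (Inverse.strictlyInverseʳ σ i))
      where
      blockPerm : ℕ ↔ ℕ → Sym m
      blockPerm τ = τ ×-↔ ↔-id (Fin m)
      blockPerm∈G : ∀ τ → (G ∈G) (blockPerm τ)
      blockPerm∈G τ = blockPerms τ (blockPerm τ) (λ _ _ → refl)
      bσ bσ⁻¹ : Sym m
      bσ = blockPerm σ
      bσ⁻¹ = blockPerm (↔-sym σ)
      g∘bσ∈G : (G ∈G) (g ↔-∘ bσ)
      g∘bσ∈G = has-comp G g∈G (blockPerm∈G σ) (λ _ → refl)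

    witness-lower : ∀ {k π} → TowerWitness k π → TowerWitness 0 π
    witness-lower {k} (witness φ φ-real _ φ-at) =
      witness (φ ∘ transpose 0 k) (realisable-reindex (transposition 0 k) φ-real) (λ _ ())
        (λ r → trans (cong (λ i → φ i ⟨$⟩ʳ r) (transpose-ˡ 0 k)) (φ-at r))

    witness-descend : ∀ {k π} → 1 ≤ k → TowerWitness k π → TowerWitness 1 π
    witness-descend {k} 1≤k (witness φ φ-real φ-trivial φ-at) =
      witness (φ ∘ transpose 1 k) (realisable-reindex (transposition 1 k) φ-real) trivial
        (λ r → trans (cong (λ i → φ i ⟨$⟩ʳ r) (transpose-ˡ 1 k)) (φ-at r))
      where
      trivial : ∀ j → j < 1 → φ (transpose 1 k j) ≈ id
      trivial zero _ r = trans (cong (λ i → φ i ⟨$⟩ʳ r) (transpose-≢ 1 k (λ ()) (<⇒≢ 1≤k)))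
                               (φ-trivial 0 1≤k r)
      trivial (suc _) (s≤s ())

    witness-conjugate : ∀ {k κ π τ} → TowerWitness 0 κ → TowerWitness k π →
      τ ≈ flip κ ∘ₚ π ∘ₚ κ → TowerWitness k τ
    witness-conjugate {k} {κ} {π} {τ} (witness θ θ-real _ θ-at) (witness φ φ-real φ-trivial φ-at)
                      τ≈κ⁻¹πκ =
      witness (λ i → flip (ψ i) ∘ₚ (φ i ∘ₚ ψ i))
        (realisable-∘ (realisable-flip ψ-real) (realisable-∘ φ-real ψ-real))
        trivial at-k
      where
      ψ : BlockFamily
      ψ = θ ∘ transpose 0 k
      ψ-real : Realisable ψ
      ψ-real = realisable-reindex (transposition 0 k) θ-real
      ψ-at : ∀ r → ψ k ⟨$⟩ʳ r ≡ κ ⟨$⟩ʳ r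
      ψ-at r = trans (cong (λ i → θ i ⟨$⟩ʳ r) (transpose-ʳ 0 k)) (θ-at r)
      trivial : ∀ j → j < k → flip (ψ j) ∘ₚ (φ j ∘ₚ ψ j) ≈ id
      trivial j j<k r = trans (cong (ψ j ⟨$⟩ʳ_) (φ-trivial j j<k _)) (inverseʳ (ψ j))
      at-k : flip (ψ k) ∘ₚ (φ k ∘ₚ ψ k) ≈ τ
      at-k r = begin
        ψ k ⟨$⟩ʳ (φ k ⟨$⟩ʳ (ψ k ⟨$⟩ˡ r))   ≡⟨ ψ-at _ ⟩
        κ ⟨$⟩ʳ (φ k ⟨$⟩ʳ (ψ k ⟨$⟩ˡ r))     ≡⟨ cong (κ ⟨$⟩ʳ_) (φ-at _) ⟩
        κ ⟨$⟩ʳ (π ⟨$⟩ʳ (ψ k ⟨$⟩ˡ r))       ≡⟨ cong ((κ ⟨$⟩ʳ_) ∘ (π ⟨$⟩ʳ_)) (flip-cong (ψ k) κ ψ-at r) ⟩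
        κ ⟨$⟩ʳ (π ⟨$⟩ʳ (κ ⟨$⟩ˡ r))         ≡⟨ sym (τ≈κ⁻¹πκ r) ⟩
        τ ⟨$⟩ʳ r                           ∎
        where open ≡-Reasoning

    witness-ascend : ∀ k {π} → TowerWitness 1 π → TowerWitness k π
    witness-ascend k {π} (witness φ φ-real φ-trivial φ-at) =
      witness (λ i → flip (ρ i) ∘ₚ ρ (transpose k (suc k) i))
        (realisable-∘ (realisable-flip ρ-real)
                      (realisable-reindex (transposition k (suc k)) ρ-real))
        trivial at-k
      where
      ρ : BlockFamily
      ρ = φ ∘ transpose 1 (suc k) ∘ transpose 0 k
      ρ-real : Realisable ρ
      ρ-real = realisable-reindex (transposition 0 k)
                 (realisable-reindex (transposition 1 (suc k)) φ-real)
      ρ-k : ρ k ≡ φ 0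
      ρ-k = trans (cong (φ ∘ transpose 1 (suc k)) (transpose-ʳ 0 k))
                  (cong φ (transpose-≢ 1 (suc k) (λ ()) (λ ())))
      ρ-suc-k : ρ (suc k) ≡ φ 1
      ρ-suc-k = trans (cong (φ ∘ transpose 1 (suc k)) (transpose-≢ 0 k (λ ()) 1+n≢n))
                      (cong φ (transpose-ʳ 1 (suc k)))
      trivial : ∀ j → j < k → flip (ρ j) ∘ₚ ρ (transpose k (suc k) j) ≈ id
      trivial j j<k r =
        trans (cong (λ i → ρ i ⟨$⟩ʳ (ρ j ⟨$⟩ˡ r)) j-fixed) (inverseʳ (ρ j))
        where
        j-fixed : transpose k (suc k) j ≡ j
        j-fixed = transpose-≢ k (suc k) (<⇒≢ j<k) (<⇒≢ (m<n⇒m<1+n j<k))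
      at-k : flip (ρ k) ∘ₚ ρ (transpose k (suc k) k) ≈ π
      at-k r = begin
        ρ (transpose k (suc k) k) ⟨$⟩ʳ (ρ k ⟨$⟩ˡ r)
          ≡⟨ cong₂ (λ i s → ρ i ⟨$⟩ʳ s) (transpose-ˡ k (suc k)) (cong (_⟨$⟩ˡ r) ρ-k) ⟩
        ρ (suc k) ⟨$⟩ʳ (φ 0 ⟨$⟩ˡ r)
          ≡⟨ cong₂ _⟨$⟩ʳ_ ρ-suc-k (flip-cong (φ 0) id (φ-trivial 0 (n<1+n 0)) r) ⟩
        φ 1 ⟨$⟩ʳ r
          ≡⟨ φ-at r ⟩
        π ⟨$⟩ʳ r
          ∎
        where open ≡-Reasoning

    tower-normal : ∀ k → IsNormalSubgroupOf (Tower G k) (Tower G 0)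
    tower-normal k =
        (λ π → witness⇒tower ∘ witness-lower ∘ tower⇒witness {k} {π})
      , (λ π π≈id → witness⇒tower {k} {π} (witness-id π≈id))
      , (λ π ρ τ π∈H ρ∈H τ≈ρ∘π →
           witness⇒tower {k} {τ} (witness-∘ (witness-of π π∈H) (witness-of ρ ρ∈H) τ≈ρ∘π))
      , (λ π τ π∈H τ≈π⁻¹ → witness⇒tower {k} {τ} (witness-flip (witness-of π π∈H) τ≈π⁻¹))
      , (λ κ π τ κ∈H₀ π∈H τ≈κ⁻¹πκ →
           witness⇒tower {k} {τ}
             (witness-conjugate (tower⇒witness {0} {κ} κ∈H₀) (witness-of π π∈H) τ≈κ⁻¹πκ))
      where
      witness-of : ∀ π → Tower G k π → TowerWitness k π
      witness-of π = tower⇒witness {k} {π}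

    tower-stable : ∀ k → 1 ≤ k → ∀ π → Tower G k π ⇔ Tower G 1 π
    tower-stable k 1≤k π =
      mk⇔ (witness⇒tower ∘ witness-descend 1≤k ∘ tower⇒witness {k} {π})
          (witness⇒tower ∘ witness-ascend k ∘ tower⇒witness {1} {π})

proposition4p16 : (m : ℕ) → .{{_ : NonZero m}} → (G : PermGroup m) →
    Closed G → POligomorphic G → BlocksAreMaximalFinite G →
    InducesFullSymOnBlocks G → BlockPermutationsInG G →
    Σ (Permutation′ m → Set) λ H →
      IsNormalSubgroupOf H (Tower G 0) ×
      (∀ i → 1 ≤ i → ∀ π → Tower G i π ⇔ H π)
proposition4p16 m G _ _ _ _ blockPerms =
  Tower G 1 , tower-normal G blockPerms 1 , tower-stable G blockPerms
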